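{- Let $G$ be a graph on $[n]$ and $p\in[0,1]^n$, and suppose there exist $y_1,\dots,y_n>0$ with $p_i\le y_i/Y_{\Gamma^+(i)}$ for all $i$. Then for every $S\subseteq[n]$ and $a\in S$, $$\frac{\breve q_S}{\breve q_{S\setminus\{a\}}}\ \ge\ \frac{Y_{[n]\setminus S}}{Y_{([n]\setminus S)\cup\{a\}}}.$$
   Context: $\mathsf{Ind}$ is the family of independent sets of $G$ (including $\emptyset$), $\Gamma^+(i)$ is $i$ together with its neighbours. $y^I=\prod_{i\in I}y_i$, $Y_S=\sum_{I\subseteq S,\,I\in\mathsf{Ind}}y^I$. $p^I=\prod_{i\in I}p_i$ and $\breve q_S=\sum_{I\in\mathsf{Ind},\,I\subseteq S}(-1)^{|I|}p^I$ (so $\breve q_\emptyset=1$); the statement includes that the denominators are positive where used. -}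

module Defs where

open import Level using (Level; _⊔_) renaming (suc to lsuc)
open import Data.Nat using (ℕ; zero; suc)
open import Data.Bool using (Bool; true; false; _∧_; _∨_; not; if_then_else_)
open import Data.Fin using (Fin)
import Data.Fin as Fin
open import Data.Fin.Subset using (Subset; inside; outside; _∈_)
open import Data.Fin.Subset.Properties using (_⊆?_)
open import Data.Vec using (Vec; []; _∷_; lookup; tabulate)
open import Data.List using (List; []; _∷_; [_]; map; _++_; foldr; allFin)
open import Data.Bool.ListAction using (all)
open import Data.Product using (_×_)
open import Data.Sum using (_⊎_)
open import Relation.Nullary using (¬_)
open import Relation.Nullary.Decidable using (⌊_⌋)
open import Relation.Binary.Core using (Rel)
open import Relation.Binary.Structures using (IsStrictTotalOrder)
open import Relation.Binary.PropositionalEquality using (_≡_)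
open import Algebra.Bundles using (CommutativeRing)

-- Ordered fields (the real numbers are one; the statement is proved for
-- every ordered field, which in particular covers ℝ).

record OrderedField (c ℓ : Level) : Set (lsuc (c ⊔ ℓ)) where
  field
    commutativeRing : CommutativeRing c ℓ
  open CommutativeRing commutativeRing public
  infix 4 _<_
  field
    _<_                 : Rel Carrier ℓ
    <-isStrictTotalOrder : IsStrictTotalOrder _≈_ _<_
    0≉1                 : ¬ (0# ≈ 1#)
    +-monoˡ-<           : ∀ {x y} z → x < y → x + z < y + z
    *-pos               : ∀ {x y} → 0# < x → 0# < y → 0# < x * y
    _⁻¹                 : (x : Carrier) → .(¬ (x ≈ 0#)) → Carrier
    ⁻¹-inverseʳ         : ∀ x (x≉0 : ¬ (x ≈ 0#)) → x * (_⁻¹ x x≉0) ≈ 1#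

  infix 4 _≤_
  _≤_ : Rel Carrier ℓ
  x ≤ y = x < y ⊎ x ≈ y

  open IsStrictTotalOrder <-isStrictTotalOrder public
    using (irrefl)

  pos⇒≉0 : ∀ {x} → 0# < x → ¬ (x ≈ 0#)
  pos⇒≉0 0<x x≈0 = irrefl (sym x≈0) 0<x

  div : (x y : Carrier) → 0# < y → Carrier
  div x y 0<y = x * (_⁻¹ y (pos⇒≉0 0<y))

record Graph (n : ℕ) : Set where
  field
    adj     : Fin n → Fin n → Bool
    adj-sym : ∀ i j → adj i j ≡ adj j i
    adj-irr : ∀ i → adj i i ≡ false
open Graph public

allSubsets : (n : ℕ) → List (Subset n)
allSubsets zero    = [ [] ]
allSubsets (suc n) = map (inside ∷_) (allSubsets n) ++ map (outside ∷_) (allSubsets n)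

independentᵇ : ∀ {n} → Graph n → Subset n → Bool
independentᵇ {n} G I =
  all (λ i → all (λ j → not (lookup I i ∧ lookup I j ∧ adj G i j)) (allFin n)) (allFin n)

Γ⁺ : ∀ {n} → Graph n → Fin n → Subset n
Γ⁺ G i = tabulate (λ j → ⌊ i Fin.≟ j ⌋ ∨ adj G i j)

module _ {c ℓ} (F : OrderedField c ℓ) where
  open OrderedField F

  monomial : ∀ {n} → (Fin n → Carrier) → Subset n → Carrier
  monomial {n} x I = foldr (λ i acc → (if lookup I i then x i else 1#) * acc) 1# (allFin n)

  sumInd : ∀ {n} → Graph n → Subset n → (Subset n → Carrier) → Carrier
  sumInd {n} G S w =
    foldr (λ I acc → (if ⌊ I ⊆? S ⌋ ∧ independentᵇ G I then w I else 0#) + acc) 0# (allSubsets n)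

  Yof : ∀ {n} → Graph n → (Fin n → Carrier) → Subset n → Carrier
  Yof G y S = sumInd G S (monomial y)

  -- q̆_S = Σ_{I ⊆ S, I ∈ Ind} (-1)^{|I|} p^I  =  Σ_{I ⊆ S, I ∈ Ind} ∏_{i∈I} (-p_i)
  q̆ : ∀ {n} → Graph n → (Fin n → Carrier) → Subset n → Carrier
  q̆ G p S = sumInd G S (monomial (λ i → - p i))

-- Y and q̆ are both independence polynomials Z_x(S) = Σ_{I ⊆ S independent} x^I, for the weights
-- x = y and x = -p, so both obey the deletion recursion Z(S) = Z(S ∖ a) + x_a Z(S ∖ Γ⁺(a)) for a ∈ S.
-- For positive y this makes Y positive, monotone and submultiplicative, Y_C ≤ Y_{C∩A} Y_{C∖A}.
-- The theorem says φ(S ∖ a) ≤ φ(S) for φ(S) = q̆_S / Y_{∁S}. By induction on S one proves, together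
-- with q̆_S > 0, that φ is monotone on the subsets of S. Clearing denominators and expanding q̆_S and
-- Y_{∁(S∖a)} by the recursion, the step φ(S ∖ a) ≤ φ(S) reduces to
--   p_a q̆_{S∖Γ⁺(a)} Y_{∁(S∖a)} ≤ q̆_{S∖a} y_a Y_{∁(S∖a)∖Γ⁺(a)},
-- which follows from φ(S ∖ Γ⁺(a)) ≤ φ(S ∖ a), submultiplicativity with A = Γ⁺(a), and p_a Y_{Γ⁺(a)} ≤ y_a.

module Submission where

open import Defs
open import Algebra.Bundles using (CommutativeSemiring)
open import Data.Nat using (ℕ; zero; suc)
open import Data.Nat.Induction using (<-wellFounded)
open import Data.Bool using (Bool; true; false; not; _∧_; _∨_; if_then_else_; T)
open import Data.Bool.Properties using (T-∧; T-not-≡; ∨-zeroʳ)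
open import Data.Bool.ListAction using (all)
open import Data.Fin using (Fin; zero; suc)
import Data.Fin as Fin
open import Data.Fin.Subset
  using (Subset; inside; outside; _∈_; _∉_; _⊆_; _⊂_; ⊥; ⁅_⁆; ∁; _∪_; _∩_; _─_; ∣_∣)
open import Data.Fin.Subset.Properties
open import Data.List using (List; []; _∷_; allFin; map; foldr; _++_)
open import Data.List.Relation.Unary.All.Properties using (all⁺; all⁻; tabulate⁺; tabulate⁻)
open import Data.Product using (Σ; ∃; _×_; _,_; proj₁; proj₂)
open import Data.Sum as Sum using (_⊎_; inj₁; inj₂)
open import Data.Vec using (_∷_; lookup; here; there)
open import Data.Vec.Properties using ([]=⇒lookup; lookup⇒[]=; lookup∘tabulate)
open import Function using (_∘_; _⇔_; mk⇔; Equivalence)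
open import Induction.WellFounded using (WellFounded; module Subrelation; module All)
import Relation.Binary.Construct.On as On
open import Relation.Nullary using (Dec; yes; no; ¬_; does; contradiction)
open import Relation.Nullary.Decidable as Dec
  using (⌊_⌋; T?; toWitness; fromWitness; does-⇔; dec-true; dec-false; decidable-stable)
open import Relation.Binary.PropositionalEquality as ≡ using (_≡_; refl)

private variable
  n : ℕ

x∈p─q⁻ : ∀ {x : Fin n} (p q : Subset n) → x ∈ p ─ q → x ∈ p × x ∉ q
x∈p─q⁻ {x = zero}  (inside  ∷ p) (outside ∷ q) here       = here , λ ()
x∈p─q⁻ {x = zero}  (outside ∷ p) (inside  ∷ q) ()
x∈p─q⁻ {x = zero}  (outside ∷ p) (outside ∷ q) ()
x∈p─q⁻ {x = suc x} (_       ∷ p) (_       ∷ q) (there x∈) =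
  let x∈p , x∉q = x∈p─q⁻ p q x∈ in there x∈p , x∉q ∘ drop-there

⊆⇒≡⊎⊆─⁅⁆ : {p q : Subset n} → p ⊆ q → p ≡ q ⊎ ∃ λ b → b ∈ q × p ⊆ q ─ ⁅ b ⁆
⊆⇒≡⊎⊆─⁅⁆ {p = p} {q} p⊆q with nonempty? (q ─ p)
... | yes (b , b∈q─p) = let b∈q , b∉p = x∈p─q⁻ q p b∈q─p in
  inj₂ (b , b∈q , λ x∈p → x∈p∧x≢y⇒x∈p-y (p⊆q x∈p) λ { refl → b∉p x∈p })
... | no q─p-empty = inj₁ (⊆-antisym p⊆q λ {x} x∈q →
  decidable-stable (x ∈? p) λ x∉p → q─p-empty (x , x∈p∧x∉q⇒x∈p─q x∈q x∉p))

⊂-wellFounded : WellFounded (_⊂_ {n})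
⊂-wellFounded = Subrelation.wellFounded p⊂q⇒∣p∣<∣q∣ (On.wellFounded ∣_∣ <-wellFounded)

⊂-rec : ∀ {ℓ} (P : Subset n → Set ℓ) → (∀ S → (∀ {T} → T ⊂ S → P T) → P S) → ∀ S → P S
⊂-rec P = All.wfRec ⊂-wellFounded _ P

p─r∩q⊆p∩q─r : (p q r : Subset n) → (p ─ r) ∩ q ⊆ (p ∩ q) ─ r
p─r∩q⊆p∩q─r p q r x∈ =
  let x∈p─r , x∈q = x∈p∩q⁻ (p ─ r) q x∈ ; x∈p , x∉r = x∈p─q⁻ p r x∈p─r in
  x∈p∧x∉q⇒x∈p─q (x∈p∩q⁺ (x∈p , x∈q)) x∉r

p─r∩q⊆p∩q : (p q r : Subset n) → (p ─ r) ∩ q ⊆ p ∩ q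
p─r∩q⊆p∩q p q r = ⊆-trans (p─r∩q⊆p∩q─r p q r) (p─q⊆p (p ∩ q) r)

p─q⊆p─r : ∀ (p : Subset n) {q r} → r ⊆ q → p ─ q ⊆ p ─ r
p─q⊆p─r p {q} r⊆q x∈ = let x∈p , x∉q = x∈p─q⁻ p q x∈ in x∈p∧x∉q⇒x∈p─q x∈p (x∉q ∘ r⊆q)

∁[p─q]⊆∁p∪q : (p q : Subset n) → ∁ (p ─ q) ⊆ ∁ p ∪ q
∁[p─q]⊆∁p∪q p q {x} x∈ with x ∈? q
... | yes x∈q = x∈p∪q⁺ (inj₂ x∈q)
... | no  x∉q = x∈p∪q⁺ (inj₁ (x∉p⇒x∈∁p λ x∈p → x∈∁p⇒x∉p x∈ (x∈p∧x∉q⇒x∈p─q x∈p x∉q)))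

x∈⁅y⁆∪p⁻ : ∀ {x y} (p : Subset n) → x ∈ ⁅ y ⁆ ∪ p → x ≡ y ⊎ x ∈ p
x∈⁅y⁆∪p⁻ {y = y} p = Sum.map₁ (x∈⁅y⁆⇒x≡y y) ∘ x∈p∪q⁻ ⁅ y ⁆ p

x∈q⇒x∉p─q : ∀ {x : Fin n} (p : Subset n) {q} → x ∈ q → x ∉ p ─ q
x∈q⇒x∉p─q p {q} x∈q x∈p─q = proj₂ (x∈p─q⁻ p q x∈p─q) x∈q

lookup≡false⇒∉ : ∀ {x : Fin n} (p : Subset n) → lookup p x ≡ false → x ∉ p
lookup≡false⇒∉ p pₓ x∈p = contradiction (≡.trans (≡.sym ([]=⇒lookup x∈p)) pₓ) λ ()

T-all-allFin⁻ : (p : Fin n → Bool) → T (all p (allFin n)) → ∀ i → T (p i)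
T-all-allFin⁻ p = tabulate⁻ ∘ all⁺ p _

T-all-allFin⁺ : (p : Fin n → Bool) → (∀ i → T (p i)) → T (all p (allFin n))
T-all-allFin⁺ p = all⁻ p ∘ tabulate⁺

T-not-∧∧⇔ : (I : Subset n) (i j : Fin n) (b : Bool) →
  T (not (lookup I i ∧ lookup I j ∧ b)) ⇔ (i ∈ I → j ∈ I → b ≡ false)
T-not-∧∧⇔ I i j b with lookup I i in Iᵢ | lookup I j in Iⱼ
... | true  | true  = mk⇔ (λ t _ _ → Equivalence.to T-not-≡ t)
                          (λ h → Equivalence.from T-not-≡ (h (lookup⇒[]= i I Iᵢ) (lookup⇒[]= j I Iⱼ)))
... | true  | false = mk⇔ (λ _ _ j∈I → contradiction (≡.trans (≡.sym ([]=⇒lookup j∈I)) Iⱼ) λ ())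
                          _
... | false | _     = mk⇔ (λ _ i∈I → contradiction (≡.trans (≡.sym ([]=⇒lookup i∈I)) Iᵢ) λ ())
                          _

module _ (G : Graph n) where

  Independent : Subset n → Set
  Independent I = ∀ i j → i ∈ I → j ∈ I → adj G i j ≡ false

  T-independentᵇ⇔ : ∀ I → T (independentᵇ G I) ⇔ Independent I
  T-independentᵇ⇔ I = mk⇔
    (λ t i j → Equivalence.to (T-not-∧∧⇔ I i j _) (T-all-allFin⁻ _ (T-all-allFin⁻ _ t i) j))
    (λ ind → T-all-allFin⁺ _ λ i → T-all-allFin⁺ _ λ j → Equivalence.from (T-not-∧∧⇔ I i j _) (ind i j))

  Admissible : Subset n → Subset n → Set
  Admissible S I = I ⊆ S × Independent I

  T-admissibleᵇ⇔ : ∀ S I → T (⌊ I ⊆? S ⌋ ∧ independentᵇ G I) ⇔ Admissible S I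
  T-admissibleᵇ⇔ S I = mk⇔
    (λ t → let t₁ , t₂ = Equivalence.to T-∧ t in toWitness t₁ , Equivalence.to (T-independentᵇ⇔ I) t₂)
    (λ adm → Equivalence.from T-∧ (fromWitness (proj₁ adm) , Equivalence.from (T-independentᵇ⇔ I) (proj₂ adm)))

  -- via T?, so that does (admissible? S I) is definitionally the test in sumInd
  admissible? : ∀ S I → Dec (Admissible S I)
  admissible? S I = Dec.map (T-admissibleᵇ⇔ S I) (T? _)

  ∈Γ⁺⁻ : ∀ {i j} → j ∈ Γ⁺ G i → i ≡ j ⊎ adj G i j ≡ true
  ∈Γ⁺⁻ {i} {j} j∈ with i Fin.≟ j | ≡.trans (≡.sym (lookup∘tabulate _ j)) ([]=⇒lookup j∈)
  ... | yes i≡j | _        = inj₁ i≡j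
  ... | no _    | adj≡true = inj₂ adj≡true

  i∈Γ⁺i : ∀ i → i ∈ Γ⁺ G i
  i∈Γ⁺i i = lookup⇒[]= i (Γ⁺ G i) (≡.trans (lookup∘tabulate _ i) i≟i)
    where
    i≟i : ⌊ i Fin.≟ i ⌋ ∨ adj G i i ≡ true
    i≟i with i Fin.≟ i
    ... | yes _   = refl
    ... | no i≢i = contradiction refl i≢i

  adj⇒∈Γ⁺ : ∀ {i j} → adj G i j ≡ true → j ∈ Γ⁺ G i
  adj⇒∈Γ⁺ {i} {j} adj≡true = lookup⇒[]= j (Γ⁺ G i)
    (≡.trans (lookup∘tabulate _ j) (≡.trans (≡.cong (⌊ i Fin.≟ j ⌋ ∨_) adj≡true) (∨-zeroʳ _)))

  ∉Γ⁺⇒¬adj : ∀ {i j} → j ∉ Γ⁺ G i → adj G i j ≡ false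
  ∉Γ⁺⇒¬adj {i} {j} j∉ with adj G i j in adj≡
  ... | true  = contradiction (adj⇒∈Γ⁺ adj≡) j∉
  ... | false = refl

  ⁅i⁆⊆Γ⁺i : ∀ i → ⁅ i ⁆ ⊆ Γ⁺ G i
  ⁅i⁆⊆Γ⁺i i x∈⁅i⁆ with x∈⁅y⁆⇒x≡y i x∈⁅i⁆
  ... | refl = i∈Γ⁺i i

  admissible-─⁅⁆ : ∀ {S I a} → a ∉ I → Admissible S I ⇔ Admissible (S ─ ⁅ a ⁆) I
  admissible-─⁅⁆ {S} {I} {a} a∉I = mk⇔
    (λ (I⊆S , ind) → (λ i∈I → x∈p∧x≢y⇒x∈p-y (I⊆S i∈I) λ { refl → a∉I i∈I }) , ind)
    (λ (I⊆S-a , ind) → (λ i∈I → p─q⊆p S ⁅ a ⁆ (I⊆S-a i∈I)) , ind)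

  admissible-⁅⁆∪ : ∀ {S I a} → a ∈ S → a ∉ I → Admissible S (⁅ a ⁆ ∪ I) ⇔ Admissible (S ─ Γ⁺ G a) I
  admissible-⁅⁆∪ {S} {I} {a} a∈S a∉I = mk⇔ to from
    where
    to : Admissible S (⁅ a ⁆ ∪ I) → Admissible (S ─ Γ⁺ G a) I
    to (aI⊆S , ind) = (λ i∈I → x∈p∧x∉q⇒x∈p─q (aI⊆S (q⊆p∪q ⁅ a ⁆ I i∈I)) (∉Γ⁺ i∈I))
                    , λ i j i∈I j∈I → ind i j (q⊆p∪q ⁅ a ⁆ I i∈I) (q⊆p∪q ⁅ a ⁆ I j∈I)
      where
      ∉Γ⁺ : ∀ {i} → i ∈ I → i ∉ Γ⁺ G a
      ∉Γ⁺ {i} i∈I i∈Γ⁺ with ∈Γ⁺⁻ i∈Γ⁺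
      ... | inj₁ refl     = a∉I i∈I
      ... | inj₂ adj≡true =
        contradiction (≡.trans (≡.sym adj≡true) (ind a i (x∈p∪q⁺ (inj₁ (x∈⁅x⁆ a))) (q⊆p∪q ⁅ a ⁆ I i∈I))) λ ()
    from : Admissible (S ─ Γ⁺ G a) I → Admissible S (⁅ a ⁆ ∪ I)
    from (I⊆S─Γ⁺ , ind) = aI⊆S , ind′
      where
      ¬adj : ∀ {i} → i ∈ I → adj G a i ≡ false
      ¬adj i∈I = ∉Γ⁺⇒¬adj (proj₂ (x∈p─q⁻ S (Γ⁺ G a) (I⊆S─Γ⁺ i∈I)))
      aI⊆S : ⁅ a ⁆ ∪ I ⊆ S
      aI⊆S i∈ with x∈⁅y⁆∪p⁻ I i∈
      ... | inj₁ refl = a∈S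
      ... | inj₂ i∈I  = p─q⊆p S (Γ⁺ G a) (I⊆S─Γ⁺ i∈I)
      ind′ : Independent (⁅ a ⁆ ∪ I)
      ind′ i j i∈ j∈ with x∈⁅y⁆∪p⁻ I i∈ | x∈⁅y⁆∪p⁻ I j∈
      ... | inj₁ refl | inj₁ refl = adj-irr G a
      ... | inj₁ refl | inj₂ j∈I  = ¬adj j∈I
      ... | inj₂ i∈I  | inj₁ refl = ≡.trans (adj-sym G i a) (¬adj i∈I)
      ... | inj₂ i∈I  | inj₂ j∈I  = ind i j i∈I j∈I

module SubsetSum {c ℓ} (R : CommutativeSemiring c ℓ) where
  open CommutativeSemiring R hiding (zero) renaming (refl to ≈-refl; sym to ≈-sym; trans to ≈-trans)
  open import Algebra.Properties.CommutativeSemigroup +-commutativeSemigroup using (interchange)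
  open import Relation.Binary.Reasoning.Setoid setoid

  private
    ∑ˡ : List (Subset n) → (Subset n → Carrier) → Carrier
    ∑ˡ Is f = foldr (λ I acc → f I + acc) 0# Is

    ∑ˡ-++ : ∀ (Is Js : List (Subset n)) f → ∑ˡ (Is ++ Js) f ≈ ∑ˡ Is f + ∑ˡ Js f
    ∑ˡ-++ []       Js f = ≈-sym (+-identityˡ _)
    ∑ˡ-++ (I ∷ Is) Js f = ≈-trans (+-congˡ (∑ˡ-++ Is Js f)) (≈-sym (+-assoc _ _ _))

    ∑ˡ-map : ∀ {m} (g : Subset m → Subset n) Is f → ∑ˡ (map g Is) f ≡ ∑ˡ Is (f ∘ g)
    ∑ˡ-map g []       f = refl
    ∑ˡ-map g (I ∷ Is) f = ≡.cong (f (g I) +_) (∑ˡ-map g Is f)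

  ∑ : (Subset n → Carrier) → Carrier
  ∑ = ∑ˡ (allSubsets _)

  ∑-cong : {f g : Subset n → Carrier} → (∀ I → f I ≈ g I) → ∑ f ≈ ∑ g
  ∑-cong {f = f} {g} f≈g = go (allSubsets _)
    where
    go : ∀ Is → ∑ˡ Is f ≈ ∑ˡ Is g
    go []       = ≈-refl
    go (I ∷ Is) = +-cong (f≈g I) (go Is)

  ∑-0 : ∑ {n} (λ _ → 0#) ≈ 0#
  ∑-0 {n} = go (allSubsets n)
    where
    go : ∀ Is → ∑ˡ {n} Is (λ _ → 0#) ≈ 0#
    go []       = ≈-refl
    go (I ∷ Is) = ≈-trans (+-identityˡ _) (go Is)

  ∑-*ˡ : ∀ x (f : Subset n → Carrier) → ∑ (λ I → x * f I) ≈ x * ∑ f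
  ∑-*ˡ x f = go (allSubsets _)
    where
    go : ∀ Is → ∑ˡ Is (λ I → x * f I) ≈ x * ∑ˡ Is f
    go []       = ≈-sym (zeroʳ x)
    go (I ∷ Is) = ≈-trans (+-congˡ (go Is)) (≈-sym (distribˡ x _ _))

  ∑-∷ : ∀ (f : Subset (suc n) → Carrier) → ∑ f ≈ ∑ (f ∘ (inside ∷_)) + ∑ (f ∘ (outside ∷_))
  ∑-∷ f = begin
    ∑ˡ (map (inside ∷_) Is ++ map (outside ∷_) Is) f      ≈⟨ ∑ˡ-++ (map (inside ∷_) Is) _ f ⟩
    ∑ˡ (map (inside ∷_) Is) f + ∑ˡ (map (outside ∷_) Is) f
      ≡⟨ ≡.cong₂ _+_ (∑ˡ-map (inside ∷_) Is f) (∑ˡ-map (outside ∷_) Is f) ⟩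
    ∑ (f ∘ (inside ∷_)) + ∑ (f ∘ (outside ∷_))            ∎
    where Is = allSubsets _

  ∑-⊥ : ∀ (f : Subset n → Carrier) → (∀ {i} I → i ∈ I → f I ≈ 0#) → ∑ f ≈ f ⊥
  ∑-⊥ {zero}  f _   = +-identityʳ _
  ∑-⊥ {suc n} f f≈0 = begin
    ∑ f                                      ≈⟨ ∑-∷ f ⟩
    ∑ (f ∘ (inside ∷_)) + ∑ (f ∘ (outside ∷_))
      ≈⟨ +-cong (≈-trans (∑-cong λ I → f≈0 (inside ∷ I) here) (∑-0 {n}))
                (∑-⊥ (f ∘ (outside ∷_)) λ I i∈I → f≈0 (outside ∷ I) (there i∈I)) ⟩
    0# + f ⊥                                 ≈⟨ +-identityˡ _ ⟩
    f ⊥                                      ∎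

  avoiding : Fin n → (Subset n → Carrier) → Subset n → Carrier
  avoiding a f I = if lookup I a then 0# else f I

  ∑-avoiding-zero : ∀ (f : Subset (suc n) → Carrier) → ∑ (avoiding zero f) ≈ ∑ (f ∘ (outside ∷_))
  ∑-avoiding-zero {n} f = begin
    ∑ (avoiding zero f)                      ≈⟨ ∑-∷ (avoiding zero f) ⟩
    ∑ {n} (λ _ → 0#) + ∑ (f ∘ (outside ∷_))  ≈⟨ +-congʳ (∑-0 {n}) ⟩
    0# + ∑ (f ∘ (outside ∷_))                ≈⟨ +-identityˡ _ ⟩
    ∑ (f ∘ (outside ∷_))                     ∎

  -- every subset is uniquely I or ⁅ a ⁆ ∪ I with a ∉ I
  ∑-split : ∀ (a : Fin n) (f : Subset n → Carrier) →
    ∑ f ≈ ∑ (avoiding a f) + ∑ (avoiding a (f ∘ (⁅ a ⁆ ∪_)))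
  ∑-split {suc n} zero f = begin
    ∑ f                                      ≈⟨ ∑-∷ f ⟩
    ∑ fᵢ + ∑ fₒ                               ≈⟨ +-comm _ _ ⟩
    ∑ fₒ + ∑ fᵢ
      ≈⟨ +-cong (∑-avoiding-zero f) (≈-trans (∑-avoiding-zero (f ∘ (⁅ zero ⁆ ∪_))) (∑-cong λ I → reflexive (≡.cong fᵢ (∪-identityˡ I)))) ⟨
    ∑ (avoiding zero f) + ∑ (avoiding zero (f ∘ (⁅ zero ⁆ ∪_)))  ∎
    where
    fᵢ fₒ : Subset n → Carrier
    fᵢ = f ∘ (inside ∷_)
    fₒ = f ∘ (outside ∷_)
  ∑-split {suc n} (suc a) f = begin
    ∑ f                                      ≈⟨ ∑-∷ f ⟩
    ∑ fᵢ + ∑ fₒ                               ≈⟨ +-cong (∑-split a fᵢ) (∑-split a fₒ) ⟩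
    (∑ (avoiding a fᵢ) + ∑ (avoiding a (fᵢ ∘ (⁅ a ⁆ ∪_)))) + (∑ (avoiding a fₒ) + ∑ (avoiding a (fₒ ∘ (⁅ a ⁆ ∪_))))
      ≈⟨ interchange _ _ _ _ ⟩
    (∑ (avoiding a fᵢ) + ∑ (avoiding a fₒ)) + (∑ (avoiding a (fᵢ ∘ (⁅ a ⁆ ∪_))) + ∑ (avoiding a (fₒ ∘ (⁅ a ⁆ ∪_))))
      ≈⟨ +-cong (∑-∷ (avoiding (suc a) f)) (∑-∷ (avoiding (suc a) (f ∘ (⁅ suc a ⁆ ∪_)))) ⟨
    ∑ (avoiding (suc a) f) + ∑ (avoiding (suc a) (f ∘ (⁅ suc a ⁆ ∪_)))  ∎
    where
    fᵢ fₒ : Subset n → Carrier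
    fᵢ = f ∘ (inside ∷_)
    fₒ = f ∘ (outside ∷_)

module OrderedFieldProperties {c ℓ} (F : OrderedField c ℓ) where
  open OrderedField F hiding (zero) renaming (refl to ≈-refl; sym to ≈-sym; trans to ≈-trans)
  open import Algebra.Properties.Ring ring using (-1*x≈-x; -‿involutive; x[y-z]≈xy-xz)
  open import Algebra.Properties.CommutativeSemigroup *-commutativeSemigroup using (xy∙z≈xz∙y)
  open import Relation.Binary.Bundles using (StrictTotalOrder)
  open import Relation.Binary.Definitions using (tri<; tri≈; tri>)

  strictTotalOrder : StrictTotalOrder c ℓ ℓ
  strictTotalOrder = record { isStrictTotalOrder = <-isStrictTotalOrder }

  open StrictTotalOrder strictTotalOrder public using (compare; asym; <-respˡ-≈; <-respʳ-≈)
  open import Relation.Binary.Reasoning.StrictPartialOrder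
    (StrictTotalOrder.strictPartialOrder strictTotalOrder) public

  <⇒≤ : ∀ {x y} → x < y → x ≤ y
  <⇒≤ = inj₁

  ≤-refl : ∀ {x} → x ≤ x
  ≤-refl = inj₂ ≈-refl

  ≤-trans : ∀ {x y z} → x ≤ y → y ≤ z → x ≤ z
  ≤-trans x≤y y≤z = begin _ ≤⟨ x≤y ⟩ _ ≤⟨ y≤z ⟩ _ ∎

  ≤⇒≯ : ∀ {x y} → x ≤ y → ¬ (y < x)
  ≤⇒≯ x≤y y<x = begin-contradiction
    _ <⟨ y<x ⟩
    _ ≤⟨ x≤y ⟩
    _ ∎

  +-monoʳ-< : ∀ {x y} z → x < y → z + x < z + y
  +-monoʳ-< {x} {y} z x<y = begin-strict
    z + x ≈⟨ +-comm z x ⟩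
    x + z <⟨ +-monoˡ-< z x<y ⟩
    y + z ≈⟨ +-comm y z ⟩
    z + y ∎

  +-monoˡ-≤ : ∀ {x y} z → x ≤ y → x + z ≤ y + z
  +-monoˡ-≤ z (inj₁ x<y) = inj₁ (+-monoˡ-< z x<y)
  +-monoˡ-≤ z (inj₂ x≈y) = inj₂ (+-congʳ x≈y)

  +-monoʳ-≤ : ∀ {x y} z → x ≤ y → z + x ≤ z + y
  +-monoʳ-≤ z (inj₁ x<y) = inj₁ (+-monoʳ-< z x<y)
  +-monoʳ-≤ z (inj₂ x≈y) = inj₂ (+-congˡ x≈y)

  +-mono-≤ : ∀ {x y u v} → x ≤ y → u ≤ v → x + u ≤ y + v
  +-mono-≤ {y = y} {u} x≤y u≤v = begin
    _     ≤⟨ +-monoˡ-≤ u x≤y ⟩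
    y + u ≤⟨ +-monoʳ-≤ y u≤v ⟩
    _     ∎

  +-pos : ∀ {x y} → 0# < x → 0# < y → 0# < x + y
  +-pos {x} {y} 0<x 0<y = begin-strict
    0#      ≈⟨ +-identityʳ 0# ⟨
    0# + 0# <⟨ +-monoˡ-< 0# 0<x ⟩
    x + 0#  <⟨ +-monoʳ-< x 0<y ⟩
    x + y   ∎

  x≤x+y : ∀ {x y} → 0# ≤ y → x ≤ x + y
  x≤x+y {x} {y} 0≤y = begin
    x      ≈⟨ +-identityʳ x ⟨
    x + 0# ≤⟨ +-monoʳ-≤ x 0≤y ⟩
    x + y  ∎

  x≤y⇒0≤y-x : ∀ {x y} → x ≤ y → 0# ≤ y - x
  x≤y⇒0≤y-x {x} {y} x≤y = begin
    0#    ≈⟨ -‿inverseʳ x ⟨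
    x - x ≤⟨ +-monoˡ-≤ (- x) x≤y ⟩
    y - x ∎

  x<y⇒0<y-x : ∀ {x y} → x < y → 0# < y - x
  x<y⇒0<y-x {x} {y} x<y = begin-strict
    0#    ≈⟨ -‿inverseʳ x ⟨
    x - x <⟨ +-monoˡ-< (- x) x<y ⟩
    y - x ∎

  0<y-x⇒x<y : ∀ {x y} → 0# < y - x → x < y
  0<y-x⇒x<y {x} {y} 0<y-x = begin-strict
    x            ≈⟨ +-identityˡ x ⟨
    0# + x       <⟨ +-monoˡ-< x 0<y-x ⟩
    y - x + x    ≈⟨ +-assoc y (- x) x ⟩
    y + (- x + x) ≈⟨ +-congˡ (-‿inverseˡ x) ⟩
    y + 0#       ≈⟨ +-identityʳ y ⟩
    y            ∎

  0<1 : 0# < 1#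
  0<1 with compare 0# 1#
  ... | tri< 0<1 _ _ = 0<1
  ... | tri≈ _ 0≈1 _ = contradiction 0≈1 0≉1
  ... | tri> _ _ 1<0 = contradiction 1<0 (asym 0<1′)
    where
    0<-1 : 0# < - 1#
    0<-1 = <-respʳ-≈ (+-identityˡ (- 1#)) (x<y⇒0<y-x 1<0)
    0<1′ : 0# < 1#
    0<1′ = <-respʳ-≈ (≈-trans (-1*x≈-x (- 1#)) (-‿involutive 1#)) (*-pos 0<-1 0<-1)

  *-monoˡ-< : ∀ {x y z} → 0# < z → x < y → z * x < z * y
  *-monoˡ-< {x} {y} {z} 0<z x<y = 0<y-x⇒x<y (<-respʳ-≈ (x[y-z]≈xy-xz z y x) (*-pos 0<z (x<y⇒0<y-x x<y)))

  *-monoʳ-< : ∀ {x y z} → 0# < z → x < y → x * z < y * z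
  *-monoʳ-< {x} {y} {z} 0<z x<y = begin-strict
    x * z ≈⟨ *-comm x z ⟩
    z * x <⟨ *-monoˡ-< 0<z x<y ⟩
    z * y ≈⟨ *-comm z y ⟩
    y * z ∎

  *-monoˡ-≤ : ∀ {x y z} → 0# ≤ z → x ≤ y → z * x ≤ z * y
  *-monoˡ-≤ (inj₁ 0<z) (inj₁ x<y) = inj₁ (*-monoˡ-< 0<z x<y)
  *-monoˡ-≤ (inj₁ 0<z) (inj₂ x≈y) = inj₂ (*-congˡ x≈y)
  *-monoˡ-≤ {x} {y} {z} (inj₂ 0≈z) _ = inj₂ (begin-equality
    z * x  ≈⟨ *-congʳ 0≈z ⟨
    0# * x ≈⟨ zeroˡ x ⟩
    0#     ≈⟨ zeroˡ y ⟨
    0# * y ≈⟨ *-congʳ 0≈z ⟩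
    z * y  ∎)

  *-monoʳ-≤ : ∀ {x y z} → 0# ≤ z → x ≤ y → x * z ≤ y * z
  *-monoʳ-≤ {x} {y} {z} 0≤z x≤y = begin
    x * z ≈⟨ *-comm x z ⟩
    z * x ≤⟨ *-monoˡ-≤ 0≤z x≤y ⟩
    z * y ≈⟨ *-comm z y ⟩
    y * z ∎

  *-mono-≤ : ∀ {x y u v} → 0# ≤ x → 0# ≤ u → x ≤ y → u ≤ v → x * u ≤ y * v
  *-mono-≤ {x} {y} {u} {v} 0≤x 0≤u x≤y u≤v = begin
    x * u ≤⟨ *-monoʳ-≤ 0≤u x≤y ⟩
    y * u ≤⟨ *-monoˡ-≤ (≤-trans 0≤x x≤y) u≤v ⟩
    y * v ∎

  *-cancelʳ-≤ : ∀ {x y z} → 0# < z → x * z ≤ y * z → x ≤ y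
  *-cancelʳ-≤ {x} {y} 0<z xz≤yz with compare x y
  ... | tri< x<y _ _ = inj₁ x<y
  ... | tri≈ _ x≈y _ = inj₂ x≈y
  ... | tri> _ _ y<x = contradiction (*-monoʳ-< 0<z y<x) (≤⇒≯ xz≤yz)

  *-cancelʳ-< : ∀ {x y z} → 0# < z → x * z < y * z → x < y
  *-cancelʳ-< {x} {y} 0<z xz<yz with compare x y
  ... | tri< x<y _ _ = x<y
  ... | tri≈ _ x≈y _ = contradiction (<-respˡ-≈ (*-congʳ x≈y) xz<yz) (irrefl ≈-refl)
  ... | tri> _ _ y<x = contradiction (*-monoʳ-< 0<z y<x) (asym xz<yz)

  pos-*-pos⇒pos : ∀ {x y} → 0# < y → 0# < x * y → 0# < x
  pos-*-pos⇒pos {x} {y} 0<y 0<xy = *-cancelʳ-< 0<y (<-respˡ-≈ (≈-sym (zeroˡ y)) 0<xy)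

  div-*-cancel : ∀ x y (0<y : 0# < y) → div x y 0<y * y ≈ x
  div-*-cancel x y 0<y = begin-equality
    x * y⁻¹ * y   ≈⟨ xy∙z≈xz∙y x y⁻¹ y ⟩
    x * y * y⁻¹   ≈⟨ *-assoc x y y⁻¹ ⟩
    x * (y * y⁻¹) ≈⟨ *-congˡ (⁻¹-inverseʳ y (pos⇒≉0 0<y)) ⟩
    x * 1#        ≈⟨ *-identityʳ x ⟩
    x             ∎
    where y⁻¹ = _⁻¹ y (pos⇒≉0 0<y)

  ≤-div⇒*-≤ : ∀ {x y z} (0<z : 0# < z) → x ≤ div y z 0<z → x * z ≤ y
  ≤-div⇒*-≤ {x} {y} {z} 0<z x≤y/z = begin
    x * z            ≤⟨ *-monoʳ-≤ (<⇒≤ 0<z) x≤y/z ⟩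
    div y z 0<z * z  ≈⟨ div-*-cancel y z 0<z ⟩
    y                ∎

  *-≤-*⇒div-≤-div : ∀ {x y u v} (0<y : 0# < y) (0<v : 0# < v) →
    x * v ≤ u * y → div x y 0<y ≤ div u v 0<v
  *-≤-*⇒div-≤-div {x} {y} {u} {v} 0<y 0<v xv≤uy = *-cancelʳ-≤ (*-pos 0<y 0<v) (begin
    div x y 0<y * (y * v) ≈⟨ *-assoc _ y v ⟨
    div x y 0<y * y * v   ≈⟨ *-congʳ (div-*-cancel x y 0<y) ⟩
    x * v                 ≤⟨ xv≤uy ⟩
    u * y                 ≈⟨ *-congʳ (div-*-cancel u v 0<v) ⟨
    div u v 0<v * v * y   ≈⟨ xy∙z≈xz∙y _ v y ⟩
    div u v 0<v * y * v   ≈⟨ *-assoc _ y v ⟩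
    div u v 0<v * (y * v) ∎)

  -- transitivity of x₁ / w₁ ≤ x₂ / w₂ ≤ x₃ / w₃, with the denominators cleared
  cross-≤-trans : ∀ {x₁ x₂ x₃ w₁ w₂ w₃} → 0# ≤ w₁ → 0# < w₂ → 0# ≤ w₃ →
    x₁ * w₂ ≤ x₂ * w₁ → x₂ * w₃ ≤ x₃ * w₂ → x₁ * w₃ ≤ x₃ * w₁
  cross-≤-trans {x₁} {x₂} {x₃} {w₁} {w₂} {w₃} 0≤w₁ 0<w₂ 0≤w₃ ₁≤₂ ₂≤₃ = *-cancelʳ-≤ 0<w₂ (begin
    x₁ * w₃ * w₂ ≈⟨ xy∙z≈xz∙y x₁ w₃ w₂ ⟩
    x₁ * w₂ * w₃ ≤⟨ *-monoʳ-≤ 0≤w₃ ₁≤₂ ⟩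
    x₂ * w₁ * w₃ ≈⟨ xy∙z≈xz∙y x₂ w₁ w₃ ⟩
    x₂ * w₃ * w₁ ≤⟨ *-monoʳ-≤ 0≤w₁ ₂≤₃ ⟩
    x₃ * w₂ * w₁ ≈⟨ xy∙z≈xz∙y x₃ w₂ w₁ ⟩
    x₃ * w₁ * w₂ ∎)

module IndependencePolynomial {c ℓ} (F : OrderedField c ℓ) where
  open OrderedField F hiding (zero) renaming (refl to ≈-refl; sym to ≈-sym; trans to ≈-trans)
  open OrderedFieldProperties F
  open SubsetSum commutativeSemiring using (∑; ∑-cong; ∑-*ˡ; ∑-⊥; ∑-split; avoiding)
  open import Algebra.Properties.CommutativeSemigroup *-commutativeSemigroup using (x∙yz≈y∙xz)
  open import Algebra.Properties.Ring ring using (-‿distribˡ-*)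
  open import Data.List.Properties using (map-tabulate; foldr-map)

  monomial-∷ : ∀ {m} (x : Fin (suc m) → Carrier) b I →
    monomial F x (b ∷ I) ≡ (if b then x zero else 1#) * monomial F (x ∘ suc) I
  monomial-∷ {m} x b I = ≡.cong ((if b then x zero else 1#) *_)
    (≡.trans (≡.cong (foldr factor 1#) (≡.sym (map-tabulate {n = m} (λ i → i) Fin.suc)))
             (foldr-map factor Fin.suc 1# (allFin m)))
    where
    factor : Fin (suc m) → Carrier → Carrier
    factor i acc = (if lookup (b ∷ I) i then x i else 1#) * acc

  monomial-⊥ : ∀ {m} (x : Fin m → Carrier) → monomial F x ⊥ ≈ 1#
  monomial-⊥ {zero}  x = ≈-refl
  monomial-⊥ {suc m} x = begin-equality
    monomial F x ⊥                      ≡⟨ monomial-∷ x outside ⊥ ⟩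
    1# * monomial F (x ∘ Fin.suc) ⊥     ≈⟨ *-identityˡ _ ⟩
    monomial F (x ∘ Fin.suc) ⊥          ≈⟨ monomial-⊥ (x ∘ Fin.suc) ⟩
    1#                                  ∎

  monomial-⁅⁆∪ : ∀ {m} (x : Fin m → Carrier) {a I} → a ∉ I → monomial F x (⁅ a ⁆ ∪ I) ≈ x a * monomial F x I
  monomial-⁅⁆∪ x {zero}  {inside  ∷ I} a∉I = contradiction here a∉I
  monomial-⁅⁆∪ x {zero}  {outside ∷ I} _   = begin-equality
    monomial F x (inside ∷ (⊥ ∪ I))            ≡⟨ monomial-∷ x inside (⊥ ∪ I) ⟩
    x zero * monomial F (x ∘ Fin.suc) (⊥ ∪ I)  ≡⟨ ≡.cong (λ J → x zero * monomial F (x ∘ Fin.suc) J) (∪-identityˡ I) ⟩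
    x zero * monomial F (x ∘ Fin.suc) I        ≈⟨ *-congˡ (*-identityˡ _) ⟨
    x zero * (1# * monomial F (x ∘ Fin.suc) I) ≡⟨ ≡.cong (x zero *_) (monomial-∷ x outside I) ⟨
    x zero * monomial F x (outside ∷ I)        ∎
  monomial-⁅⁆∪ x {suc a} {b ∷ I} a∉I = begin-equality
    monomial F x (b ∷ (⁅ a ⁆ ∪ I))                 ≡⟨ monomial-∷ x b (⁅ a ⁆ ∪ I) ⟩
    xb * monomial F (x ∘ Fin.suc) (⁅ a ⁆ ∪ I)      ≈⟨ *-congˡ (monomial-⁅⁆∪ (x ∘ Fin.suc) (a∉I ∘ there)) ⟩
    xb * (x (suc a) * monomial F (x ∘ Fin.suc) I)  ≈⟨ x∙yz≈y∙xz xb (x (suc a)) _ ⟩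
    x (suc a) * (xb * monomial F (x ∘ Fin.suc) I)  ≡⟨ ≡.cong (x (suc a) *_) (monomial-∷ x b I) ⟨
    x (suc a) * monomial F x (b ∷ I)               ∎
    where xb = if b then x zero else 1#

  if-scale : ∀ {b b′ u v} k → b ≡ b′ → u ≈ k * v → (if b then u else 0#) ≈ k * (if b′ then v else 0#)
  if-scale {false} k ≡.refl _   = ≈-sym (zeroʳ k)
  if-scale {true}  k ≡.refl u≈kv = u≈kv

  module _ {n} (G : Graph n) where

    summand : (Fin n → Carrier) → Subset n → Subset n → Carrier
    summand x S I = if does (admissible? G S I) then monomial F x I else 0#

    summand-vanishes : ∀ {x S I a} → a ∈ I → a ∉ S → summand x S I ≈ 0#
    summand-vanishes {x} {S} {I} a∈I a∉S = reflexive (≡.cong (λ b → if b then monomial F x I else 0#)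
      (dec-false (admissible? G S I) λ adm → a∉S (proj₁ adm a∈I)))

    avoiding-summand : ∀ x S a I → avoiding a (summand x S) I ≈ summand x (S ─ ⁅ a ⁆) I
    avoiding-summand x S a I with lookup I a in Iₐ
    ... | true  = ≈-sym (summand-vanishes (lookup⇒[]= a I Iₐ) (x∈q⇒x∉p─q S (x∈⁅x⁆ a)))
    ... | false = reflexive (≡.cong (λ b → if b then monomial F x I else 0#)
                    (does-⇔ (admissible-─⁅⁆ G (lookup≡false⇒∉ I Iₐ)) (admissible? G S I) (admissible? G (S ─ ⁅ a ⁆) I)))

    avoiding-summand-⁅⁆∪ : ∀ x {S a} → a ∈ S → ∀ I →
      avoiding a (summand x S ∘ (⁅ a ⁆ ∪_)) I ≈ x a * summand x (S ─ Γ⁺ G a) I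
    avoiding-summand-⁅⁆∪ x {S} {a} a∈S I with lookup I a in Iₐ
    ... | true  = ≈-sym (≈-trans (*-congˡ (summand-vanishes (lookup⇒[]= a I Iₐ) (x∈q⇒x∉p─q S (i∈Γ⁺i G a))))
                                 (zeroʳ (x a)))
    ... | false = if-scale (x a)
                    (does-⇔ (admissible-⁅⁆∪ G a∈S a∉I) (admissible? G S (⁅ a ⁆ ∪ I)) (admissible? G (S ─ Γ⁺ G a) I))
                    (monomial-⁅⁆∪ x a∉I)
      where a∉I = lookup≡false⇒∉ I Iₐ

    Yof-recursion : ∀ x {S a} → a ∈ S →
      Yof F G x S ≈ Yof F G x (S ─ ⁅ a ⁆) + x a * Yof F G x (S ─ Γ⁺ G a)
    Yof-recursion x {S} {a} a∈S = begin-equality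
      ∑ (summand x S)
        ≈⟨ ∑-split a (summand x S) ⟩
      ∑ (avoiding a (summand x S)) + ∑ (avoiding a (summand x S ∘ (⁅ a ⁆ ∪_)))
        ≈⟨ +-cong (∑-cong (avoiding-summand x S a)) (∑-cong (avoiding-summand-⁅⁆∪ x a∈S)) ⟩
      ∑ (summand x (S ─ ⁅ a ⁆)) + ∑ (λ I → x a * summand x (S ─ Γ⁺ G a) I)
        ≈⟨ +-congˡ (∑-*ˡ (x a) (summand x (S ─ Γ⁺ G a))) ⟩
      ∑ (summand x (S ─ ⁅ a ⁆)) + x a * ∑ (summand x (S ─ Γ⁺ G a))
        ∎

    Yof-⊥ : ∀ x → Yof F G x ⊥ ≈ 1#
    Yof-⊥ x = begin-equality
      ∑ (summand x ⊥)  ≈⟨ ∑-⊥ (summand x ⊥) (λ I i∈I → summand-vanishes i∈I ∉⊥) ⟩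
      summand x ⊥ ⊥    ≡⟨ ≡.cong (λ b → if b then monomial F x ⊥ else 0#)
                             (dec-true (admissible? G ⊥ ⊥) (⊆-refl , λ i _ i∈⊥ → contradiction i∈⊥ ∉⊥)) ⟩
      monomial F x ⊥   ≈⟨ monomial-⊥ x ⟩
      1#               ∎

    S─Γ⁺⊂S : ∀ {S a} → a ∈ S → S ─ Γ⁺ G a ⊂ S
    S─Γ⁺⊂S {S} {a} a∈S = p∩q≢∅⇒p─q⊂p S (Γ⁺ G a) (a , x∈p∩q⁺ (a∈S , i∈Γ⁺i G a))

    module _ {y : Fin n → Carrier} (y-pos : ∀ i → 0# < y i) where

      Y : Subset n → Carrier
      Y = Yof F G y

      Y-pos : ∀ S → 0# < Y S
      Y-pos = ⊂-rec _ step
        where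
        step : ∀ S → (∀ {T} → T ⊂ S → 0# < Y T) → 0# < Y S
        step S ih with nonempty? S
        ... | no  S-empty    = ≡.subst (λ T → 0# < Y T) (≡.sym (Empty-unique S-empty))
                                 (<-respʳ-≈ (≈-sym (Yof-⊥ y)) 0<1)
        ... | yes (a , a∈S) = <-respʳ-≈ (≈-sym (Yof-recursion y a∈S))
                                 (+-pos (ih (x∈p⇒p-x⊂p a∈S)) (*-pos (y-pos a) (ih (S─Γ⁺⊂S a∈S))))

      Y-nonneg : ∀ S → 0# ≤ Y S
      Y-nonneg S = <⇒≤ (Y-pos S)

      Y-mono : ∀ {R S} → R ⊆ S → Y R ≤ Y S
      Y-mono {S = S} = ⊂-rec Dominates step S
        where
        Dominates : Subset n → Set ℓ
        Dominates S = ∀ {R} → R ⊆ S → Y R ≤ Y S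

        step : ∀ S → (∀ {T} → T ⊂ S → Dominates T) → Dominates S
        step S ih R⊆S with ⊆⇒≡⊎⊆─⁅⁆ R⊆S
        ... | inj₁ ≡.refl               = ≤-refl
        ... | inj₂ (b , b∈S , R⊆S─b) = begin
          Y _                                    ≤⟨ ih (x∈p⇒p-x⊂p b∈S) R⊆S─b ⟩
          Y (S ─ ⁅ b ⁆)                          ≤⟨ x≤x+y (<⇒≤ (*-pos (y-pos b) (Y-pos _))) ⟩
          Y (S ─ ⁅ b ⁆) + y b * Y (S ─ Γ⁺ G b)   ≈⟨ Yof-recursion y b∈S ⟨
          Y S                                    ∎

      Y-submultiplicative : ∀ C A → Y C ≤ Y (C ∩ A) * Y (C ∩ ∁ A)
      Y-submultiplicative = ⊂-rec _ step
        where
        Splits : Subset n → Set ℓ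
        Splits C = ∀ A → Y C ≤ Y (C ∩ A) * Y (C ∩ ∁ A)

        split : ∀ {C c} → (∀ {D} → D ⊂ C → Splits D) → c ∈ C → ∀ A → c ∈ A → Y C ≤ Y (C ∩ A) * Y (C ∩ ∁ A)
        split {C} {c} ih c∈C A c∈A = begin
          Y C
            ≈⟨ Yof-recursion y c∈C ⟩
          Y (C ─ ⁅ c ⁆) + y c * Y (C ─ Γ⁺ G c)
            ≤⟨ +-mono-≤ (ih (x∈p⇒p-x⊂p c∈C) A) (*-monoˡ-≤ y-nonneg (ih (S─Γ⁺⊂S c∈C) A)) ⟩
          Y ((C ─ ⁅ c ⁆) ∩ A) * Y ((C ─ ⁅ c ⁆) ∩ ∁ A) + y c * (Y ((C ─ Γ⁺ G c) ∩ A) * Y ((C ─ Γ⁺ G c) ∩ ∁ A))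
            ≤⟨ +-mono-≤ (shrink ⁅ c ⁆) (*-monoˡ-≤ y-nonneg (shrink (Γ⁺ G c))) ⟩
          Y ((C ∩ A) ─ ⁅ c ⁆) * Y (C ∩ ∁ A) + y c * (Y ((C ∩ A) ─ Γ⁺ G c) * Y (C ∩ ∁ A))
            ≈⟨ ≈-trans (+-congˡ (≈-sym (*-assoc _ _ _))) (≈-sym (distribʳ _ _ _)) ⟩
          (Y ((C ∩ A) ─ ⁅ c ⁆) + y c * Y ((C ∩ A) ─ Γ⁺ G c)) * Y (C ∩ ∁ A)
            ≈⟨ *-congʳ (Yof-recursion y (x∈p∩q⁺ (c∈C , c∈A))) ⟨
          Y (C ∩ A) * Y (C ∩ ∁ A)
            ∎
          where
          y-nonneg : 0# ≤ y c
          y-nonneg = <⇒≤ (y-pos c)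
          shrink : ∀ T → Y ((C ─ T) ∩ A) * Y ((C ─ T) ∩ ∁ A) ≤ Y ((C ∩ A) ─ T) * Y (C ∩ ∁ A)
          shrink T = *-mono-≤ (Y-nonneg _) (Y-nonneg _)
                       (Y-mono (p─r∩q⊆p∩q─r C A T)) (Y-mono (p─r∩q⊆p∩q C (∁ A) T))

        step : ∀ C → (∀ {D} → D ⊂ C → Splits D) → Splits C
        step C ih A with nonempty? C
        ... | no C-empty rewrite Empty-unique C-empty = begin
          Y ⊥                      ≈⟨ Yof-⊥ y ⟩
          1#                       ≈⟨ *-identityˡ 1# ⟨
          1# * 1#                  ≈⟨ *-cong (Yof-⊥ y) (Yof-⊥ y) ⟨
          Y ⊥ * Y ⊥                ≡⟨ ≡.cong₂ (λ U V → Y U * Y V) (∩-zeroˡ A) (∩-zeroˡ (∁ A)) ⟨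
          Y (⊥ ∩ A) * Y (⊥ ∩ ∁ A)  ∎
        ... | yes (c , c∈C) with c ∈? A
        ...   | yes c∈A = split ih c∈C A c∈A
        ...   | no  c∉A = begin
          Y C                            ≤⟨ split ih c∈C (∁ A) (x∉p⇒x∈∁p c∉A) ⟩
          Y (C ∩ ∁ A) * Y (C ∩ ∁ (∁ A))  ≤⟨ *-monoˡ-≤ (Y-nonneg _) (Y-mono C∩∁∁A⊆C∩A) ⟩
          Y (C ∩ ∁ A) * Y (C ∩ A)        ≈⟨ *-comm _ _ ⟩
          Y (C ∩ A) * Y (C ∩ ∁ A)        ∎
          where
          C∩∁∁A⊆C∩A : C ∩ ∁ (∁ A) ⊆ C ∩ A
          C∩∁∁A⊆C∩A x∈ = let x∈C , x∈∁∁A = x∈p∩q⁻ C _ x∈ in x∈p∩q⁺ (x∈C , x∉∁p⇒x∈p (x∈∁p⇒x∉p x∈∁∁A))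

      module _ {p : Fin n → Carrier} (p-nonneg : ∀ i → 0# ≤ p i)
               (p-bound : ∀ i → p i * Y (Γ⁺ G i) ≤ y i) where

        q : Subset n → Carrier
        q = q̆ F G p

        -- R ≼ S is φ(R) ≤ φ(S) with the denominators cleared
        _≼_ : Subset n → Subset n → Set ℓ
        R ≼ S = q R * Y (∁ S) ≤ q S * Y (∁ R)

        ≼-trans : ∀ {R S T} → R ≼ S → S ≼ T → R ≼ T
        ≼-trans = cross-≤-trans (Y-nonneg _) (Y-pos _) (Y-nonneg _)

        ─⁅⁆-≼ : ∀ {S a} → a ∈ S → 0# ≤ q (S ─ ⁅ a ⁆) → (S ─ Γ⁺ G a) ≼ (S ─ ⁅ a ⁆) → (S ─ ⁅ a ⁆) ≼ S
        ─⁅⁆-≼ {S} {a} a∈S 0≤q₀ Γ≼a = begin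
          q₀ * Y (∁ S)                  ≤⟨ *-monoˡ-≤ 0≤q₀ (Y-mono ∁S⊆W─a) ⟩
          q₀ * Y (W ─ ⁅ a ⁆)            ≤⟨ x≤x+y (x≤y⇒0≤y-x loss≤gain) ⟩
          q₀ * Y (W ─ ⁅ a ⁆) + (q₀ * (y a * Y (W ─ Γ)) - p a * (q₁ * Y W))  ≈⟨ expand ⟩
          q S * Y W                     ∎
          where
          Γ W : Subset n
          Γ = Γ⁺ G a
          W = ∁ (S ─ ⁅ a ⁆)
          q₀ q₁ : Carrier
          q₀ = q (S ─ ⁅ a ⁆)
          q₁ = q (S ─ Γ)

          a∈W : a ∈ W
          a∈W = x∉p⇒x∈∁p (x∈q⇒x∉p─q S (x∈⁅x⁆ a))

          ∁S⊆W─a : ∁ S ⊆ W ─ ⁅ a ⁆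
          ∁S⊆W─a x∈∁S = x∈p∧x≢y⇒x∈p-y (x∉p⇒x∈∁p (x∈∁p⇒x∉p x∈∁S ∘ p─q⊆p S ⁅ a ⁆))
                                      λ { ≡.refl → x∈∁p⇒x∉p x∈∁S a∈S }

          ∁S─Γ∩∁Γ⊆W─Γ : ∁ (S ─ Γ) ∩ ∁ Γ ⊆ W ─ Γ
          ∁S─Γ∩∁Γ⊆W─Γ x∈ = let x∈∁S─Γ , x∈∁Γ = x∈p∩q⁻ (∁ (S ─ Γ)) (∁ Γ) x∈ ; x∉Γ = x∈∁p⇒x∉p x∈∁Γ in
            x∈p∧x∉q⇒x∈p─q (x∉p⇒x∈∁p λ x∈S─a →
              x∈∁p⇒x∉p x∈∁S─Γ (x∈p∧x∉q⇒x∈p─q (p─q⊆p S ⁅ a ⁆ x∈S─a) x∉Γ)) x∉Γ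

          Y∁S─Γ≤ : Y (∁ (S ─ Γ)) ≤ Y Γ * Y (W ─ Γ)
          Y∁S─Γ≤ = begin
            Y (∁ (S ─ Γ))                              ≤⟨ Y-submultiplicative (∁ (S ─ Γ)) Γ ⟩
            Y (∁ (S ─ Γ) ∩ Γ) * Y (∁ (S ─ Γ) ∩ ∁ Γ)    ≤⟨ *-mono-≤ (Y-nonneg _) (Y-nonneg _)
                                                           (Y-mono (p∩q⊆q _ Γ)) (Y-mono ∁S─Γ∩∁Γ⊆W─Γ) ⟩
            Y Γ * Y (W ─ Γ)                            ∎

          loss≤gain : p a * (q₁ * Y W) ≤ q₀ * (y a * Y (W ─ Γ))
          loss≤gain = begin
            p a * (q₁ * Y W)                ≤⟨ *-monoˡ-≤ (p-nonneg a) Γ≼a ⟩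
            p a * (q₀ * Y (∁ (S ─ Γ)))      ≤⟨ *-monoˡ-≤ (p-nonneg a) (*-monoˡ-≤ 0≤q₀ Y∁S─Γ≤) ⟩
            p a * (q₀ * (Y Γ * Y (W ─ Γ)))  ≈⟨ x∙yz≈y∙xz (p a) q₀ _ ⟩
            q₀ * (p a * (Y Γ * Y (W ─ Γ)))  ≈⟨ *-congˡ (*-assoc (p a) (Y Γ) _) ⟨
            q₀ * (p a * Y Γ * Y (W ─ Γ))    ≤⟨ *-monoˡ-≤ 0≤q₀ (*-monoʳ-≤ (Y-nonneg _) (p-bound a)) ⟩
            q₀ * (y a * Y (W ─ Γ))          ∎

          expand : q₀ * Y (W ─ ⁅ a ⁆) + (q₀ * (y a * Y (W ─ Γ)) - p a * (q₁ * Y W)) ≈ q S * Y W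
          expand = begin-equality
            q₀ * Y (W ─ ⁅ a ⁆) + (q₀ * (y a * Y (W ─ Γ)) - p a * (q₁ * Y W))
              ≈⟨ +-assoc _ _ _ ⟨
            q₀ * Y (W ─ ⁅ a ⁆) + q₀ * (y a * Y (W ─ Γ)) - p a * (q₁ * Y W)
              ≈⟨ +-cong (distribˡ q₀ _ _) (-‿cong (*-assoc (p a) q₁ (Y W))) ⟨
            q₀ * (Y (W ─ ⁅ a ⁆) + y a * Y (W ─ Γ)) - p a * q₁ * Y W
              ≈⟨ +-cong (*-congˡ (Yof-recursion y a∈W)) (≈-sym (≈-trans (-‿distribˡ-* (p a * q₁) (Y W)) (*-congʳ (-‿distribˡ-* (p a) q₁)))) ⟨
            q₀ * Y W + - p a * q₁ * Y W
              ≈⟨ distribʳ (Y W) q₀ _ ⟨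
            (q₀ + - p a * q₁) * Y W
              ≈⟨ *-congʳ (Yof-recursion (λ i → - p i) a∈S) ⟨
            q S * Y W
              ∎

        q-pos×monotone : ∀ S → 0# < q S × (∀ {R} → R ⊆ S → R ≼ S)
        q-pos×monotone = ⊂-rec _ step
          where
          step : ∀ S → (∀ {T} → T ⊂ S → 0# < q T × (∀ {R} → R ⊆ T → R ≼ T)) →
                 0# < q S × (∀ {R} → R ⊆ S → R ≼ S)
          step S ih = q-pos , monotone
            where
            deletion : ∀ {a} → a ∈ S → (S ─ ⁅ a ⁆) ≼ S
            deletion {a} a∈S = let q-pos′ , monotone′ = ih (x∈p⇒p-x⊂p a∈S) in
              ─⁅⁆-≼ a∈S (<⇒≤ q-pos′) (monotone′ (p─q⊆p─r S (⁅i⁆⊆Γ⁺i G a)))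

            q-pos : 0# < q S
            q-pos with nonempty? S
            ... | no  S-empty    = ≡.subst (λ T → 0# < q T) (≡.sym (Empty-unique S-empty))
                                     (<-respʳ-≈ (≈-sym (Yof-⊥ _)) 0<1)
            ... | yes (a , a∈S) = pos-*-pos⇒pos (Y-pos _) (begin-strict
              0#                       <⟨ *-pos (proj₁ (ih (x∈p⇒p-x⊂p a∈S))) (Y-pos (∁ S)) ⟩
              q (S ─ ⁅ a ⁆) * Y (∁ S)  ≤⟨ deletion a∈S ⟩
              q S * Y (∁ (S ─ ⁅ a ⁆))  ∎)

            monotone : ∀ {R} → R ⊆ S → R ≼ S
            monotone R⊆S with ⊆⇒≡⊎⊆─⁅⁆ R⊆S
            ... | inj₁ ≡.refl               = ≤-refl
            ... | inj₂ (b , b∈S , R⊆S─b) = ≼-trans (proj₂ (ih (x∈p⇒p-x⊂p b∈S)) R⊆S─b) (deletion b∈S)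

lemma5p41 : ∀ {c ℓ} (F : OrderedField c ℓ) → let open OrderedField F in
    (n : ℕ) (G : Graph n) (p : Fin n → Carrier) →
    (∀ i → 0# ≤ p i × p i ≤ 1#) →
    (y : Fin n → Carrier) → (∀ i → 0# < y i) →
    (∀ i → (hY : 0# < Yof F G y (Γ⁺ G i)) → p i ≤ div (y i) (Yof F G y (Γ⁺ G i)) hY) →
    (S : Subset n) (a : Fin n) → a ∈ S →
    Σ (0# < q̆ F G p (S ─ ⁅ a ⁆)) λ hq →
    Σ (0# < Yof F G y (∁ S ∪ ⁅ a ⁆)) λ hY →
    div (Yof F G y (∁ S)) (Yof F G y (∁ S ∪ ⁅ a ⁆)) hY
    ≤ div (q̆ F G p S) (q̆ F G p (S ─ ⁅ a ⁆)) hq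
lemma5p41 F n G p p∈[0,1] y y-pos p≤y/Y S a a∈S =
  q-pos (S ─ ⁅ a ⁆) , Y-pos G y-pos _ , *-≤-*⇒div-≤-div (Y-pos G y-pos _) (q-pos _) (begin
    Yof F G y (∁ S) * q̆ F G p (S ─ ⁅ a ⁆)  ≈⟨ *-comm _ _ ⟩
    q̆ F G p (S ─ ⁅ a ⁆) * Yof F G y (∁ S)  ≤⟨ proj₂ (q-pos×monotone′ S) (p─q⊆p S ⁅ a ⁆) ⟩
    q̆ F G p S * Yof F G y (∁ (S ─ ⁅ a ⁆))  ≤⟨ *-monoˡ-≤ (<⇒≤ (q-pos S)) (Y-mono G y-pos (∁[p─q]⊆∁p∪q S ⁅ a ⁆)) ⟩
    q̆ F G p S * Yof F G y (∁ S ∪ ⁅ a ⁆)    ∎)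
  where
  open OrderedField F using (0#; _*_; _<_; _≤_; *-comm)
  open OrderedFieldProperties F
  open IndependencePolynomial F

  p-bound : ∀ i → p i * Yof F G y (Γ⁺ G i) ≤ y i
  p-bound i = ≤-div⇒*-≤ (Y-pos G y-pos _) (p≤y/Y i (Y-pos G y-pos _))

  q-pos×monotone′ : ∀ T → 0# < q̆ F G p T ×
    (∀ {R} → R ⊆ T → q̆ F G p R * Yof F G y (∁ T) ≤ q̆ F G p T * Yof F G y (∁ R))
  q-pos×monotone′ = q-pos×monotone G y-pos (proj₁ ∘ p∈[0,1]) p-bound

  q-pos : ∀ T → 0# < q̆ F G p T
  q-pos = proj₁ ∘ q-pos×monotone′
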